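{- Let $S=\{a,b\}$ with $a\neq b$, and let $p$ be a proposition such that $\neg\neg p$ holds. Define $\mathcal{J}_p:\mathrm{Pow}(S)\to\mathrm{Pow}(S)$ by $x\in\mathcal{J}_p(U)$ iff $x\in U$ and $(b\notin U\Rightarrow p)$, and define $\mathcal{A}_p:\mathrm{Pow}(S)\to\mathrm{Pow}(S)$ by $x\in\mathcal{A}_p(U)$ iff for all $V\subseteq S$, $x\in\mathcal{J}_p(V)$ implies $U\between\mathcal{J}_p(V)$. Then $\{a\}$ splits $\mathcal{A}_p$, i.e. for all $U\subseteq S$, $\mathcal{A}_p(U)\between\{a\}$ implies $U\between\{a\}$.
   Context: All reasoning is intuitionistic (no law of excluded middle). For $U,V\subseteq S$, $U\between V$ means there exists $x\in U\cap V$. ($\mathcal{J}_p$ is a reduction on $S$ and $\mathcal{A}_p$ is the greatest saturation compatible with it.) -}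

module Defs where

open import Level using (Level; _⊔_; suc; zero)
open import Data.Product using (Σ; _×_; _,_)
open import Relation.Nullary using (¬_)
open import Relation.Binary.PropositionalEquality using (_≡_)

data S : Set where
  a b : S

Pow : (ℓ : Level) → Set (suc ℓ)
Pow ℓ = S → Set ℓ

_∈_ : ∀ {ℓ} → S → Pow ℓ → Set ℓ
x ∈ U = U x

_≬_ : ∀ {ℓ ℓ'} → Pow ℓ → Pow ℓ' → Set (ℓ ⊔ ℓ')
U ≬ V = Σ S (λ x → x ∈ U × x ∈ V)

｛a｝ : Pow zero
｛a｝ x = x ≡ a

J : Set → Pow zero → Pow zero
J p U x = x ∈ U × (¬ (b ∈ U) → p)

-- A_p(U) : x ∈ A_p(U) iff for all V ⊆ S, x ∈ J_p(V) → U ≬ J_p(V).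
-- Quantifying over all V : Pow zero makes A_p(U) a subset at level 1
-- (predicative universes).
A : Set → Pow zero → Pow (suc zero)
A p U x = (V : Pow zero) → x ∈ J p V → U ≬ J p V

SplitsA : Set → Set₁
SplitsA p = (U : Pow zero) → A p U ≬ ｛a｝ → U ≬ ｛a｝

-- Test A_p(U) ∋ a against V = {a} ∪ {b | p}. Since ¬¬p, a ∈ J_p(V), so U meets
-- J_p(V) ⊆ V. A meeting point is either a, or b together with a proof of p; in
-- the latter case p makes J_p the identity, so testing against {a} instead
-- yields a point of U in {a}.
module Submission where

open import Defs
open import Level using (zero)
open import Relation.Nullary using (¬_)
open import Data.Product using (_,_; _×_)
open import Data.Empty using (⊥-elim)
open import Data.Sum using (_⊎_; inj₁; inj₂)
open import Relation.Binary.PropositionalEquality using (_≡_; refl)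

｛a｝∪｛b∣_｝ : Set → Pow zero
｛a｝∪｛b∣ p ｝ x = x ≡ a ⊎ (x ≡ b × p)

∈⇒∈J : ∀ {p U x} → p → x ∈ U → x ∈ J p U
∈⇒∈J q x∈U = x∈U , λ _ → q

a∈J[｛a｝∪｛b∣p｝] : ∀ {p} → ¬ ¬ p → a ∈ J p ｛a｝∪｛b∣ p ｝
a∈J[｛a｝∪｛b∣p｝] ¬¬p = inj₁ refl , λ b∉V → ⊥-elim (¬¬p λ q → b∉V (inj₂ (refl , q)))

A∋a⇒≬｛a｝ : ∀ {p U} → ¬ ¬ p → a ∈ A p U → U ≬ ｛a｝
A∋a⇒≬｛a｝ ¬¬p a∈AU with a∈AU ｛a｝∪｛b∣ _ ｝ (a∈J[｛a｝∪｛b∣p｝] ¬¬p)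
... | x , x∈U , inj₁ x≡a , _ = x , x∈U , x≡a
... | _ , _ , inj₂ (_ , q) , _ with a∈AU ｛a｝ (∈⇒∈J {U = ｛a｝} q refl)
...   | y , y∈U , y≡a , _ = y , y∈U , y≡a

lemma4p6 : (p : Set) → ¬ ¬ p → SplitsA p
lemma4p6 p ¬¬p U (.a , a∈AU , refl) = A∋a⇒≬｛a｝ ¬¬p a∈AU
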